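{- Let $n\geqslant 5$ be an integer and let $c:E(K_n)\to\mathbb{N}$ be a proper edge-colouring of the complete graph $K_n$ on $n$ vertices. (i) If at least $n$ colours are used by $c$, then there is a subset $U\subseteq V(K_n)$ with $|U|=\lfloor (n+3)/2\rfloor$ such that $c$ uses at least $n$ colours on the edges of $K_n[U]$. (ii) If $c$ uses $n-1$ colours, then there is a subset $U\subseteq V(K_n)$ with $|U|=n/2+1$ such that $c$ uses $n-1$ colours on the edges of $K_n[U]$.
   Context: $K_n[U]$ denotes the subgraph of $K_n$ induced by the vertex set $U$. An edge-colouring is proper if any two edges sharing an endpoint receive different colours. -}

module Defs where

open import Data.Nat using (ℕ)
open import Data.Fin using (Fin)
open import Data.Fin.Subset using (Subset; _∈_; ⊤)
open import Data.Product using (Σ; ∃; ∃-syntax; _×_; _,_)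
open import Function.Definitions using (Injective)
open import Relation.Binary.PropositionalEquality using (_≡_; _≢_)

-- An edge-colouring of K_n with colours in ℕ: a function on ordered pairs
-- of vertices that is symmetric on distinct pairs (so it is a function on
-- the edges {i,j}); the diagonal values c i i are irrelevant.
Colouring : ℕ → Set
Colouring n = Fin n → Fin n → ℕ

IsEdgeColouring : ∀ {n} → Colouring n → Set
IsEdgeColouring {n} c = ∀ (i j : Fin n) → i ≢ j → c i j ≡ c j i

Proper : ∀ {n} → Colouring n → Set
Proper {n} c = ∀ (i j k : Fin n) → i ≢ j → i ≢ k → j ≢ k → c i j ≢ c i k

UsedOn : ∀ {n} → Colouring n → Subset n → ℕ → Set
UsedOn {n} c U x = ∃[ i ] ∃[ j ] (i ∈ U × j ∈ U × i ≢ j × c i j ≡ x)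

UsesAtLeast : ∀ {n} → Colouring n → Subset n → ℕ → Set
UsesAtLeast {n} c U k =
  Σ (Fin k → ℕ) λ f → Injective _≡_ _≡_ f × (∀ t → UsedOn c U (f t))

UsesExactly : ∀ {n} → Colouring n → Subset n → ℕ → Set
UsesExactly {n} c U k =
  Σ (Fin k → ℕ) λ f → Injective _≡_ _≡_ f × (∀ t → UsedOn c U (f t))
    × (∀ x → UsedOn c U x → ∃[ t ] f t ≡ x)

-- (i) We grow a vertex set U greedily, keeping the duplicate-free list L of the
-- colours on K_n[U].  The seed is a triangle a, b, d where the colour of bd is
-- absent at a.  Every v ∈ U has at most |L| edges with colours in L (one fewer
-- at a), so it sends at least n - 1 - |L| edges with new colours out of U;
-- double counting and averaging then give some w ∉ U whose addition brings more
-- than j new colours whenever j (n - |U|) + (|L| + 1) |U| ≤ n |U|.  A first step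
-- of gain 3 followed by steps of gain 0, 1 or 2 maintains n ≤ |L| + 2t, where t
-- is the number of steps left, until |U| = ⌊(n+3)/2⌋.
-- (ii) With n - 1 colours each vertex sees every colour, so each colour class is
-- a perfect matching, and a set of more than n/2 vertices contains an edge of it.
module Submission where

open import Defs
open import Data.Nat using (ℕ; zero; suc; _+_; _*_; _∸_; _/_; _%_; _≤_; _<_; _≤?_; _<?_; z≤n; s≤s)
open import Data.Nat.Properties hiding (_≟_)
open import Data.Nat.Properties using () renaming (_≟_ to _≟ℕ_)
open import Data.Nat.DivMod using (m≡m%n+[m/n]*n; m%n<n; m/n*n≤m)
open import Data.Nat.Tactic.RingSolver using (solve-∀)
open import Data.Fin using (Fin; zero; suc; _≟_; inject≤; fromℕ<)
open import Data.Fin.Properties using (any?; inject≤-injective)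
open import Data.Fin.Subset using (Subset; ⊤; ⊥; ⁅_⁆; _∪_; ∁; ∣_∣; inside; outside; _⊆_)
  renaming (_∈_ to _∈ₛ_; _∉_ to _∉ₛ_)
open import Data.Fin.Subset.Properties
  using (∣∁p∣≡n∸∣p∣; ∣⊤∣≡n; ∣⊥∣≡0; ∣⁅x⁆∣≡1; ∣p∣≤n; p⊆q⇒∣p∣≤∣q∣; ∪-identityʳ; ∈⊤; x∉p⇒x∈∁p; x∉∁p⇒x∈p; x∈∁p⇒x∉p;
         x∈p∪q⁻; p⊆p∪q; q⊆p∪q; x∈⁅x⁆; x∈⁅y⁆⇒x≡y)
  renaming (_∈?_ to _∈ₛ?_)
open import Data.Vec using () renaming ([] to []ᵥ; _∷_ to _∷ᵥ_; here to hereᵥ; there to thereᵥ)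
open import Data.List using (List; []; _∷_; _++_; length; map; filter; tabulate; lookup; allFin)
open import Data.List.Properties using (length-map; length-++; length-tabulate; length-removeAt′)
open import Data.List.Membership.Propositional using (_∈_; _∉_)
open import Data.List.Membership.Propositional.Properties
  using (∈-map⁺; ∈-map⁻; ∈-filter⁺; ∈-filter⁻; ∈-allFin; ∈-++⁻; ∈-++⁺ˡ; ∈-++⁺ʳ; ∈-lookup)
open import Data.List.Membership.DecPropositional _≟ℕ_ using (_∈?_)
open import Data.List.Relation.Unary.Any using (here; there; _─_)
open import Data.List.Relation.Unary.All as All using ([]; _∷_)
import Data.List.Relation.Unary.All.Properties as AllP
open import Data.List.Relation.Unary.AllPairs using ([]; _∷_)
open import Data.List.Relation.Unary.Unique.Propositional using (Unique)
import Data.List.Relation.Unary.Unique.Propositional.Properties as Unique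
open import Data.Product using (Σ; ∃; ∃-syntax; _×_; _,_; proj₁; proj₂)
open import Data.Sum using (_⊎_; inj₁; inj₂)
open import Function using (_∘_)
open import Function.Definitions using (Injective)
open import Relation.Nullary using (Dec; yes; no; ¬_; ¬?; _×-dec_; contradiction)
open import Relation.Unary using (Pred; Decidable)
open import Relation.Binary.PropositionalEquality
open import Algebra.Properties.Semiring.Sum +-*-semiring
  using (sum; sum-syntax; sum-cong-≗; sum-replicate-zero; ∑-distrib-+; ∑-comm; *-distribˡ-sum)
open import Algebra.Properties.CommutativeSemigroup *-commutativeSemigroup using (x∙yz≈y∙xz)

𝟙 : ∀ {p} {P : Set p} → Dec P → ℕ
𝟙 (yes _) = 1
𝟙 (no _)  = 0

𝟙-× : ∀ {p q} {P : Set p} {Q : Set q} (p? : Dec P) (q? : Dec Q) → 𝟙 (p? ×-dec q?) ≡ 𝟙 p? * 𝟙 q?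
𝟙-× (yes _) (yes _) = refl
𝟙-× (yes _) (no _)  = refl
𝟙-× (no _)  _       = refl

∑-mono-≤ : ∀ {n} {f g : Fin n → ℕ} → (∀ i → f i ≤ g i) → sum f ≤ sum g
∑-mono-≤ {zero}  f≤g = z≤n
∑-mono-≤ {suc n} f≤g = +-mono-≤ (f≤g zero) (∑-mono-≤ (f≤g ∘ suc))

∑-const-1 : ∀ n → ∑[ i < n ] 1 ≡ n
∑-const-1 zero    = refl
∑-const-1 (suc n) = cong suc (∑-const-1 n)

∑-δ : ∀ {n} (w : Fin n) → ∑[ i < n ] 𝟙 (i ≟ w) ≡ 1
∑-δ {suc n} zero    = cong suc (trans (sum-cong-≗ {n} (λ _ → refl)) (sum-replicate-zero n))
∑-δ {suc n} (suc w) = trans (sum-cong-≗ shift) (∑-δ w)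
  where
  shift : ∀ i → 𝟙 (suc i ≟ suc w) ≡ 𝟙 (i ≟ w)
  shift i with i ≟ w
  ... | yes _ = refl
  ... | no _  = refl

∑-others : ∀ {n} (w : Fin n) → ∑[ i < n ] 𝟙 (¬? (i ≟ w)) + 1 ≡ n
∑-others {n} w = begin
  ∑[ i < n ] 𝟙 (¬? (i ≟ w)) + 1                    ≡⟨ cong (∑[ i < n ] 𝟙 (¬? (i ≟ w)) +_) (∑-δ w) ⟨
  ∑[ i < n ] 𝟙 (¬? (i ≟ w)) + ∑[ i < n ] 𝟙 (i ≟ w) ≡⟨ ∑-distrib-+ (λ i → 𝟙 (¬? (i ≟ w))) (λ i → 𝟙 (i ≟ w)) ⟨
  ∑[ i < n ] (𝟙 (¬? (i ≟ w)) + 𝟙 (i ≟ w))          ≡⟨ sum-cong-≗ split ⟩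
  ∑[ i < n ] 1                                      ≡⟨ ∑-const-1 n ⟩
  n                                                 ∎
  where
  open ≡-Reasoning
  split : ∀ i → 𝟙 (¬? (i ≟ w)) + 𝟙 (i ≟ w) ≡ 1
  split i with i ≟ w
  ... | yes _ = refl
  ... | no _  = refl

∑-𝟙≡length-filter : ∀ {a p} {A : Set a} {P : Pred A p} (P? : Decidable P) {n} (g : Fin n → A) →
  ∑[ i < n ] 𝟙 (P? (g i)) ≡ length (filter P? (tabulate g))
∑-𝟙≡length-filter P? {zero}  g = refl
∑-𝟙≡length-filter P? {suc n} g with P? (g zero)
... | yes _ = cong suc (∑-𝟙≡length-filter P? (g ∘ suc))
... | no _  = ∑-𝟙≡length-filter P? (g ∘ suc)

averaging : ∀ {p} {n} {P : Pred (Fin n) p} (P? : Decidable P) (g : Fin n → ℕ) (j : ℕ) →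
  j * ∑[ i < n ] 𝟙 (P? i) < ∑[ i < n ] (𝟙 (P? i) * g i) → ∃ λ i → P i × j < g i
averaging {n = n} P? g j avg>j with any? (λ i → P? i ×-dec (j <? g i))
... | yes witness = witness
... | no none = contradiction avg>j (≤⇒≯ (begin
  ∑[ i < n ] (𝟙 (P? i) * g i)   ≤⟨ ∑-mono-≤ bounded ⟩
  ∑[ i < n ] (j * 𝟙 (P? i))    ≡⟨ *-distribˡ-sum j (λ i → 𝟙 (P? i)) ⟨
  j * ∑[ i < n ] 𝟙 (P? i)     ∎))
  where
  open ≤-Reasoning
  bounded : ∀ i → 𝟙 (P? i) * g i ≤ j * 𝟙 (P? i)
  bounded i with P? i
  ... | no _   = z≤n
  ... | yes Pi = begin
    g i + 0 ≡⟨ +-identityʳ (g i) ⟩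
    g i     ≤⟨ ≮⇒≥ (λ j<gi → none (i , Pi , j<gi)) ⟩
    j       ≡⟨ *-identityʳ j ⟨
    j * 1   ∎

module _ {a} {A : Set a} where

  ∈-─ : ∀ {x z : A} {ys} (x∈ys : x ∈ ys) → z ∈ ys → z ≢ x → z ∈ (ys ─ x∈ys)
  ∈-─ (here refl) (here refl)  z≢x = contradiction refl z≢x
  ∈-─ (here refl) (there z∈ys) z≢x = z∈ys
  ∈-─ (there x∈ys) (here z≡y)  z≢x = here z≡y
  ∈-─ (there x∈ys) (there z∈ys) z≢x = there (∈-─ x∈ys z∈ys z≢x)

  Unique-⊆⇒length≤ : ∀ {xs ys : List A} → Unique xs → (∀ {x} → x ∈ xs → x ∈ ys) →
    length xs ≤ length ys
  Unique-⊆⇒length≤ {[]}     _            _     = z≤n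
  Unique-⊆⇒length≤ {x ∷ xs} {ys} (x∉xs ∷ uxs) xs⊆ys = begin
    suc (length xs)         ≤⟨ s≤s (Unique-⊆⇒length≤ uxs xs⊆ys─x) ⟩
    suc (length (ys ─ x∈ys)) ≡⟨ length-removeAt′ ys _ ⟨
    length ys               ∎
    where
    open ≤-Reasoning
    x∈ys = xs⊆ys (here refl)
    xs⊆ys─x : ∀ {z} → z ∈ xs → z ∈ (ys ─ x∈ys)
    xs⊆ys─x z∈xs = ∈-─ x∈ys (xs⊆ys (there z∈xs)) (λ z≡x → All.lookup x∉xs z∈xs (sym z≡x))

  lookup-injective : ∀ {xs : List A} → Unique xs → ∀ i j → lookup xs i ≡ lookup xs j → i ≡ j
  lookup-injective {x ∷ xs} _           zero    zero    _  = refl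
  lookup-injective {x ∷ xs} (x∉xs ∷ _)  zero    (suc j) eq = contradiction eq (All.lookup x∉xs (∈-lookup j))
  lookup-injective {x ∷ xs} (x∉xs ∷ _)  (suc i) zero    eq = contradiction (sym eq) (All.lookup x∉xs (∈-lookup i))
  lookup-injective {x ∷ xs} (_ ∷ uxs)   (suc i) (suc j) eq = cong suc (lookup-injective uxs i j eq)

map⁺-injectiveOn : ∀ {a b} {A : Set a} {B : Set b} (f : A → B) {xs : List A} → Unique xs →
  (∀ {x x'} → x ∈ xs → x' ∈ xs → f x ≡ f x' → x ≡ x') → Unique (map f xs)
map⁺-injectiveOn f {[]}     _            _     = []
map⁺-injectiveOn f {x ∷ xs} (x∉xs ∷ uxs) f-inj =
  AllP.map⁺ (All.tabulate (λ z∈xs fx≡fz → All.lookup x∉xs z∈xs (f-inj (here refl) (there z∈xs) fx≡fz)))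
  ∷ map⁺-injectiveOn f uxs (λ p q → f-inj (there p) (there q))

∣p∣≡∑ : ∀ {n} (p : Subset n) → ∣ p ∣ ≡ ∑[ x < n ] 𝟙 (x ∈ₛ? p)
∣p∣≡∑ []ᵥ           = refl
∣p∣≡∑ (inside ∷ᵥ p)  = cong suc (trans (∣p∣≡∑ p) (sum-cong-≗ λ x → 𝟙-there x))
  where 𝟙-there : ∀ x → 𝟙 (x ∈ₛ? p) ≡ 𝟙 (suc x ∈ₛ? (inside ∷ᵥ p))
        𝟙-there x with x ∈ₛ? p
        ... | yes _ = refl
        ... | no _  = refl
∣p∣≡∑ (outside ∷ᵥ p) = trans (∣p∣≡∑ p) (sum-cong-≗ λ x → 𝟙-there x)
  where 𝟙-there : ∀ x → 𝟙 (x ∈ₛ? p) ≡ 𝟙 (suc x ∈ₛ? (outside ∷ᵥ p))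
        𝟙-there x with x ∈ₛ? p
        ... | yes _ = refl
        ... | no _  = refl

∑-∁ : ∀ {n} (p : Subset n) → ∑[ x < n ] 𝟙 (x ∈ₛ? ∁ p) ≡ n ∸ ∣ p ∣
∑-∁ p = trans (sym (∣p∣≡∑ (∁ p))) (∣∁p∣≡n∸∣p∣ p)

∣p∪⁅w⁆∣ : ∀ {n} (p : Subset n) (w : Fin n) → w ∉ₛ p → ∣ p ∪ ⁅ w ⁆ ∣ ≡ suc ∣ p ∣
∣p∪⁅w⁆∣ (inside ∷ᵥ p)  zero    w∉p = contradiction hereᵥ w∉p
∣p∪⁅w⁆∣ (outside ∷ᵥ p) zero    w∉p = cong (λ q → suc ∣ q ∣) (∪-identityʳ p)
∣p∪⁅w⁆∣ (inside ∷ᵥ p)  (suc w) w∉p = cong suc (∣p∪⁅w⁆∣ p w (λ w∈p → w∉p (thereᵥ w∈p)))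
∣p∪⁅w⁆∣ (outside ∷ᵥ p) (suc w) w∉p = ∣p∪⁅w⁆∣ p w (λ w∈p → w∉p (thereᵥ w∈p))

∃-∉ : ∀ {n} (p : Subset n) → ∣ p ∣ < n → ∃ λ w → w ∉ₛ p
∃-∉ {n} p ∣p∣<n with any? (λ w → ¬? (w ∈ₛ? p))
... | yes missed = missed
... | no  none   = contradiction (subst (_≤ ∣ p ∣) (∣⊤∣≡n n) (p⊆q⇒∣p∣≤∣q∣ ⊤⊆p)) (<⇒≱ ∣p∣<n)
  where ⊤⊆p : ⊤ ⊆ p
        ⊤⊆p {w} _ with w ∈ₛ? p
        ... | yes w∈p = w∈p
        ... | no  w∉p = contradiction (w , w∉p) none

subset-of-size : ∀ {n} k → k ≤ n → ∃ λ (U : Subset n) → ∣ U ∣ ≡ k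
subset-of-size {n} zero    _   = ⊥ , ∣⊥∣≡0 n
subset-of-size {n} (suc k) k<n with subset-of-size k (<⇒≤ k<n)
... | U , ∣U∣≡k with ∃-∉ U (subst (_< n) (sym ∣U∣≡k) k<n)
...   | w , w∉U = U ∪ ⁅ w ⁆ , trans (∣p∪⁅w⁆∣ U w w∉U) (cong suc ∣U∣≡k)

half-≤ : ∀ m → 2 * (m / 2) ≤ m
half-≤ m = subst (_≤ m) (*-comm (m / 2) 2) (m/n*n≤m m 2)

≤-half : ∀ m → m ≤ 2 * (m / 2) + 1
≤-half m = begin
  m                     ≡⟨ m≡m%n+[m/n]*n m 2 ⟩
  m % 2 + m / 2 * 2     ≤⟨ +-monoˡ-≤ (m / 2 * 2) (≤-pred (m%n<n m 2)) ⟩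
  1 + m / 2 * 2         ≡⟨ +-comm 1 (m / 2 * 2) ⟩
  m / 2 * 2 + 1         ≡⟨ cong (_+ 1) (*-comm (m / 2) 2) ⟩
  2 * (m / 2) + 1       ∎
  where open ≤-Reasoning

target-large : ∀ n → n + 2 ≤ 2 * ((n + 3) / 2)
target-large n = +-cancelʳ-≤ 1 (n + 2) _ (subst (_≤ 2 * ((n + 3) / 2) + 1) (sym (+-assoc n 2 1)) (≤-half (n + 3)))

target-≤ : ∀ {n} → 3 ≤ n → (n + 3) / 2 ≤ n
target-≤ {n} 3≤n = *-cancelˡ-≤ 2 (begin
  2 * ((n + 3) / 2)   ≤⟨ half-≤ (n + 3) ⟩
  n + 3               ≤⟨ +-monoʳ-≤ n 3≤n ⟩
  n + n               ≡⟨ cong (n +_) (+-identityʳ n) ⟨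
  2 * n               ∎)
  where open ≤-Reasoning

half-plus-one-> : ∀ n → n < (n / 2 + 1) + (n / 2 + 1)
half-plus-one-> n = begin-strict
  n                        ≤⟨ ≤-half n ⟩
  2 * (n / 2) + 1          <⟨ m<m+n (2 * (n / 2) + 1) (s≤s z≤n) ⟩
  2 * (n / 2) + 1 + 1      ≡⟨ rearrange (n / 2) ⟩
  (n / 2 + 1) + (n / 2 + 1) ∎
  where
  open ≤-Reasoning
  rearrange : ∀ h → 2 * h + 1 + 1 ≡ (h + 1) + (h + 1)
  rearrange = solve-∀

half-plus-one-≤ : ∀ {n} → 2 ≤ n → n / 2 + 1 ≤ n
half-plus-one-≤ {n} 2≤n = *-cancelˡ-≤ 2 (begin
  2 * (n / 2 + 1)     ≡⟨ *-distribˡ-+ 2 (n / 2) 1 ⟩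
  2 * (n / 2) + 2     ≤⟨ +-mono-≤ (half-≤ n) 2≤n ⟩
  n + n               ≡⟨ cong (n +_) (+-identityʳ n) ⟨
  2 * n               ∎)
  where open ≤-Reasoning

-- The first greedy step for n ≥ 6, from 3 vertices and 3 colours: the
-- averaging condition for a gain exceeding 2.
first-step-arith : ∀ {N} → 6 ≤ N → 2 * (N ∸ 3) + 4 * 3 ≤ N * 3
first-step-arith {suc (suc (suc (suc (suc (suc k)))))} (s≤s (s≤s (s≤s (s≤s (s≤s (s≤s _)))))) = begin
  2 * (3 + k) + 12    ≡⟨ lhs k ⟩
  18 + 2 * k          ≤⟨ +-monoʳ-≤ 18 (*-monoˡ-≤ k {2} {3} (s≤s (s≤s z≤n))) ⟩
  18 + 3 * k          ≡⟨ rhs k ⟩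
  (6 + k) * 3         ∎
  where
  open ≤-Reasoning
  lhs : ∀ k → 2 * (3 + k) + 12 ≡ 18 + 2 * k
  lhs = solve-∀
  rhs : ∀ k → 18 + 3 * k ≡ (6 + k) * 3
  rhs = solve-∀

-- The tight greedy step: when N = ℓ + 2t + 2 and ℓ + 2 ≤ 2u, the averaging
-- condition for a gain exceeding 1 holds.
tight-step-arith : ∀ ℓ t u → u ≤ ℓ + 2 * t + 2 → ℓ + 2 ≤ 2 * u →
  1 * (ℓ + 2 * t + 2 ∸ u) + suc ℓ * u ≤ (ℓ + 2 * t + 2) * u
tight-step-arith ℓ t zero    _   ℓ+2≤0 with ≤-trans (m≤n+m 2 ℓ) ℓ+2≤0
... | ()
tight-step-arith ℓ t u@(suc _) u≤N ℓ+2≤2u = +-cancelʳ-≤ u _ _ (begin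
  1 * (N ∸ u) + suc ℓ * u + u             ≡⟨ swap (N ∸ u) (suc ℓ * u) u ⟩
  (N ∸ u) + u + suc ℓ * u                 ≡⟨ cong (_+ suc ℓ * u) (m∸n+n≡m u≤N) ⟩
  N + suc ℓ * u                           ≡⟨ expand ℓ t u ⟩
  (ℓ + 2) + 2 * t + u + ℓ * u             ≤⟨ +-monoˡ-≤ (ℓ * u) (+-monoˡ-≤ u (+-mono-≤ ℓ+2≤2u (m≤m*n (2 * t) u))) ⟩
  2 * u + 2 * t * u + u + ℓ * u           ≡⟨ collect ℓ t u ⟩
  N * u + u                               ∎)
  where
  open ≤-Reasoning
  N = ℓ + 2 * t + 2
  swap : ∀ x y z → 1 * x + y + z ≡ x + z + y
  swap = solve-∀
  expand : ∀ ℓ t u → ℓ + 2 * t + 2 + suc ℓ * u ≡ (ℓ + 2) + 2 * t + u + ℓ * u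
  expand = solve-∀
  collect : ∀ ℓ t u → 2 * u + 2 * t * u + u + ℓ * u ≡ (ℓ + 2 * t + 2) * u + u
  collect = solve-∀

module ProperColouring {n} (c : Colouring n) (c-sym : IsEdgeColouring c) (proper : Proper c) where

  colour-injective-at : ∀ v {w w'} → w ≢ v → w' ≢ v → c v w ≡ c v w' → w ≡ w'
  colour-injective-at v {w} {w'} w≢v w'≢v eq with w ≟ w'
  ... | yes w≡w' = w≡w'
  ... | no  w≢w' = contradiction eq (proper v w w' (≢-sym w≢v) (≢-sym w'≢v) w≢w')

  neighbours : Fin n → List (Fin n)
  neighbours v = filter (λ w → ¬? (w ≟ v)) (allFin n)

  incidentColours : Fin n → List ℕ
  incidentColours v = map (c v) (neighbours v)

  ∈-neighbours⁻ : ∀ {v w} → w ∈ neighbours v → w ≢ v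
  ∈-neighbours⁻ {v} w∈ = proj₂ (∈-filter⁻ (λ w → ¬? (w ≟ v)) {xs = allFin n} w∈)

  ∈-incidentColours⁺ : ∀ {v w} → w ≢ v → c v w ∈ incidentColours v
  ∈-incidentColours⁺ {v} {w} w≢v = ∈-map⁺ (c v) (∈-filter⁺ (λ w → ¬? (w ≟ v)) (∈-allFin w) w≢v)

  ∈-incidentColours⁻ : ∀ {v z} → z ∈ incidentColours v → ∃ λ w → w ≢ v × c v w ≡ z
  ∈-incidentColours⁻ {v} z∈ with ∈-map⁻ (c v) z∈
  ... | w , w∈ , refl = w , ∈-neighbours⁻ w∈ , refl

  incidentColours-unique : ∀ v → Unique (incidentColours v)
  incidentColours-unique v =
    map⁺-injectiveOn (c v) (Unique.filter⁺ (λ w → ¬? (w ≟ v)) (Unique.allFin⁺ n))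
      (λ p q → colour-injective-at v (∈-neighbours⁻ p) (∈-neighbours⁻ q))

  length-incidentColours : ∀ v → length (incidentColours v) + 1 ≡ n
  length-incidentColours v = begin
    length (incidentColours v) + 1    ≡⟨ cong (_+ 1) (length-map (c v) (neighbours v)) ⟩
    length (neighbours v) + 1         ≡⟨ cong (_+ 1) (∑-𝟙≡length-filter (λ w → ¬? (w ≟ v)) (λ w → w)) ⟨
    ∑[ w < n ] 𝟙 (¬? (w ≟ v)) + 1      ≡⟨ ∑-others v ⟩
    n                                 ∎
    where open ≡-Reasoning

  AbsentAt : Fin n → ℕ → Set
  AbsentAt v z = ∀ w → w ≢ v → c v w ≢ z

  -- Among n distinct colours, one is absent at v, as v meets only n - 1 edges.
  absent-colour : ∀ v (f : Fin n → ℕ) → Injective _≡_ _≡_ f → ∃ λ t → AbsentAt v (f t)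
  absent-colour v f f-inj with any? (λ t → ¬? (f t ∈? incidentColours v))
  ... | yes (t , ft∉) = t , λ w w≢v cvw≡ft → ft∉ (subst (_∈ incidentColours v) cvw≡ft (∈-incidentColours⁺ w≢v))
  ... | no  none      = contradiction all-incident (<⇒≱ (begin-strict
      length (incidentColours v)       <⟨ m<m+n _ (s≤s z≤n) ⟩
      length (incidentColours v) + 1   ≡⟨ length-incidentColours v ⟩
      n                                ≡⟨ length-tabulate (λ w → w) ⟨
      length (allFin n)                ≡⟨ length-map f (allFin n) ⟨
      length (map f (allFin n))        ∎))
    where
    open ≤-Reasoning
    all-incident : length (map f (allFin n)) ≤ length (incidentColours v)
    all-incident = Unique-⊆⇒length≤ (Unique.map⁺ f-inj (Unique.allFin⁺ n)) λ z∈ → ft∈ z∈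
      where ft∈ : ∀ {z} → z ∈ map f (allFin n) → z ∈ incidentColours v
            ft∈ z∈ with ∈-map⁻ f z∈
            ... | t , _ , refl with f t ∈? incidentColours v
            ...   | yes ft∈ = ft∈
            ...   | no  ft∉ = contradiction (t , ft∉) none

  InL? : ∀ v L w → Dec (w ≢ v × c v w ∈ L)
  InL? v L w = ¬? (w ≟ v) ×-dec (c v w ∈? L)

  incidentIn : Fin n → List ℕ → ℕ
  incidentIn v L = ∑[ w < n ] 𝟙 (InL? v L w)

  module _ (v : Fin n) {L : List ℕ} where

    private
      coloursIn : List ℕ
      coloursIn = map (c v) (filter (InL? v L) (allFin n))

      ∈-coloursIn⁻ : ∀ {z} → z ∈ coloursIn → ∃ λ w → w ≢ v × c v w ≡ z × z ∈ L
      ∈-coloursIn⁻ z∈ with ∈-map⁻ (c v) z∈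
      ... | w , w∈ , refl with ∈-filter⁻ (InL? v L) {xs = allFin n} w∈
      ...   | _ , w≢v , cvw∈L = w , w≢v , refl , cvw∈L

      coloursIn-unique : Unique coloursIn
      coloursIn-unique = map⁺-injectiveOn (c v) (Unique.filter⁺ (InL? v L) (Unique.allFin⁺ n))
        λ p q → colour-injective-at v (proj₁ (proj₂ (∈-filter⁻ (InL? v L) {xs = allFin n} p)))
                                      (proj₁ (proj₂ (∈-filter⁻ (InL? v L) {xs = allFin n} q)))

      length-coloursIn : incidentIn v L ≡ length coloursIn
      length-coloursIn = trans (∑-𝟙≡length-filter (InL? v L) (λ w → w))
                               (sym (length-map (c v) (filter (InL? v L) (allFin n))))

    -- The edges at v with colour in L carry distinct colours of L ...
    incidentIn-≤ : incidentIn v L ≤ length L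
    incidentIn-≤ = subst (_≤ length L) (sym length-coloursIn)
      (Unique-⊆⇒length≤ coloursIn-unique (λ z∈ → proj₂ (proj₂ (proj₂ (∈-coloursIn⁻ z∈)))))

    incidentIn-< : ∀ {y} → y ∈ L → AbsentAt v y → incidentIn v L < length L
    incidentIn-< {y} y∈L y-absent = subst (_≤ length L) (cong suc (sym length-coloursIn))
      (Unique-⊆⇒length≤ (All.tabulate y≢ ∷ coloursIn-unique) ⊆L)
      where
      y≢ : ∀ {z} → z ∈ coloursIn → y ≢ z
      y≢ z∈ y≡z with ∈-coloursIn⁻ z∈
      ... | w , w≢v , cvw≡z , _ = y-absent w w≢v (trans cvw≡z (sym y≡z))
      ⊆L : ∀ {z} → z ∈ y ∷ coloursIn → z ∈ L
      ⊆L (here refl) = y∈L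
      ⊆L (there z∈)  = proj₂ (proj₂ (proj₂ (∈-coloursIn⁻ z∈)))

  record Stage (u : ℕ) : Set where
    field
      U      : Subset n
      size   : ∣ U ∣ ≡ u
      L      : List ℕ
      unique : Unique L
      used   : ∀ {z} → z ∈ L → UsedOn c U z
      closed : ∀ {i j} → i ∈ₛ U → j ∈ₛ U → i ≢ j → c i j ∈ L

  Fresh : Subset n → List ℕ → Fin n → Fin n → Set
  Fresh U L w v = v ∈ₛ U × c v w ∉ L

  fresh? : ∀ U L w v → Dec (Fresh U L w v)
  fresh? U L w v = (v ∈ₛ? U) ×-dec ¬? (c v w ∈? L)

  gain : Subset n → List ℕ → Fin n → ℕ
  gain U L w = ∑[ v < n ] 𝟙 (fresh? U L w v)

  freshColours : Subset n → List ℕ → Fin n → List ℕ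
  freshColours U L w = map (λ v → c v w) (filter (fresh? U L w) (allFin n))

  -- Adding a vertex w ∉ U appends its fresh colours, which are distinct since
  -- they all sit at w, and gain U L w in number.
  extend : ∀ {u} (S : Stage u) (w : Fin n) → w ∉ₛ Stage.U S → Stage (suc u)
  extend S w w∉U = record
    { U      = U ∪ ⁅ w ⁆
    ; size   = trans (∣p∪⁅w⁆∣ U w w∉U) (cong suc size)
    ; L      = L ++ new
    ; unique = Unique.++⁺ unique new-unique (λ (z∈L , z∈new) → new-fresh z∈new z∈L)
    ; used   = used′
    ; closed = closed′
    }
    where
    open Stage S
    new = freshColours U L w
    fresh-vertices = filter (fresh? U L w) (allFin n)
    fresh⁻ : ∀ {v} → v ∈ fresh-vertices → Fresh U L w v
    fresh⁻ v∈ = proj₂ (∈-filter⁻ (fresh? U L w) {xs = allFin n} v∈)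
    ≢w : ∀ {v} → v ∈ₛ U → v ≢ w
    ≢w v∈U refl = w∉U v∈U
    new-unique : Unique new
    new-unique = map⁺-injectiveOn (λ v → c v w) (Unique.filter⁺ (fresh? U L w) (Unique.allFin⁺ n))
      λ {v} {v'} p q cvw≡cv'w → colour-injective-at w (≢w (proj₁ (fresh⁻ p))) (≢w (proj₁ (fresh⁻ q)))
        (trans (c-sym w v (≢-sym (≢w (proj₁ (fresh⁻ p))))) (trans cvw≡cv'w (c-sym v' w (≢w (proj₁ (fresh⁻ q))))))
    new-fresh : ∀ {z} → z ∈ new → z ∉ L
    new-fresh z∈ with ∈-map⁻ (λ v → c v w) z∈
    ... | v , v∈ , refl = proj₂ (fresh⁻ v∈)
    widen : ∀ {z} → UsedOn c U z → UsedOn c (U ∪ ⁅ w ⁆) z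
    widen (i , j , i∈ , j∈ , i≢j , cij≡z) = i , j , p⊆p∪q ⁅ w ⁆ i∈ , p⊆p∪q ⁅ w ⁆ j∈ , i≢j , cij≡z
    used′ : ∀ {z} → z ∈ L ++ new → UsedOn c (U ∪ ⁅ w ⁆) z
    used′ z∈ with ∈-++⁻ L z∈
    ... | inj₁ z∈L   = widen (used z∈L)
    ... | inj₂ z∈new with ∈-map⁻ (λ v → c v w) z∈new
    ...   | v , v∈ , refl = v , w , p⊆p∪q ⁅ w ⁆ (proj₁ (fresh⁻ v∈)) , q⊆p∪q U ⁅ w ⁆ (x∈⁅x⁆ w) , ≢w (proj₁ (fresh⁻ v∈)) , refl
    to-w : ∀ {v} → v ∈ₛ U → c v w ∈ L ++ new
    to-w {v} v∈U with c v w ∈? L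
    ... | yes cvw∈L = ∈-++⁺ˡ cvw∈L
    ... | no  cvw∉L = ∈-++⁺ʳ L (∈-map⁺ (λ v → c v w) (∈-filter⁺ (fresh? U L w) (∈-allFin v) (v∈U , cvw∉L)))
    closed′ : ∀ {i j} → i ∈ₛ U ∪ ⁅ w ⁆ → j ∈ₛ U ∪ ⁅ w ⁆ → i ≢ j → c i j ∈ L ++ new
    closed′ {j = j} i∈ j∈ i≢j with x∈p∪q⁻ U ⁅ w ⁆ i∈ | x∈p∪q⁻ U ⁅ w ⁆ j∈
    ... | inj₁ i∈U | inj₁ j∈U = ∈-++⁺ˡ (closed i∈U j∈U i≢j)
    ... | inj₁ i∈U | inj₂ j∈w rewrite x∈⁅y⁆⇒x≡y w j∈w = to-w i∈U
    ... | inj₂ i∈w | inj₁ j∈U rewrite x∈⁅y⁆⇒x≡y w i∈w = subst (_∈ L ++ new) (c-sym j w (≢w j∈U)) (to-w j∈U)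
    ... | inj₂ i∈w | inj₂ j∈w = contradiction (trans (x∈⁅y⁆⇒x≡y w i∈w) (sym (x∈⁅y⁆⇒x≡y w j∈w))) i≢j

  length-extend : ∀ {u} (S : Stage u) w w∉U →
    length (Stage.L (extend S w w∉U)) ≡ length (Stage.L S) + gain (Stage.U S) (Stage.L S) w
  length-extend S w w∉U = begin
    length (L ++ freshColours U L w)          ≡⟨ length-++ L ⟩
    length L + length (freshColours U L w)    ≡⟨ cong (length L +_) (length-map (λ v → c v w) (filter (fresh? U L w) (allFin n))) ⟩
    length L + length (filter (fresh? U L w) (allFin n)) ≡⟨ cong (length L +_) (∑-𝟙≡length-filter (fresh? U L w) (λ v → v)) ⟨
    length L + gain U L w                     ∎
    where open ≡-Reasoning
          open Stage S

  -- A stage with a distinguished vertex a ∈ U at which a colour y ∈ L is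
  -- absent; this absent colour is what makes the counting below strict.
  record Seeded (u : ℕ) : Set where
    field
      stage    : Stage u
      a        : Fin n
      a∈U      : a ∈ₛ Stage.U stage
      y        : ℕ
      y∈L      : y ∈ Stage.L stage
      y-absent : AbsentAt a y
    open Stage stage public

  extendSeeded : ∀ {u} (T : Seeded u) (w : Fin n) → w ∉ₛ Seeded.U T → Seeded (suc u)
  extendSeeded T w w∉U = record
    { stage = extend stage w w∉U ; a = a ; a∈U = p⊆p∪q ⁅ w ⁆ a∈U
    ; y = y ; y∈L = ∈-++⁺ˡ y∈L ; y-absent = y-absent }
    where open Seeded T

  module Counting {u} (T : Seeded u) where
    open Seeded T

    ℓ : ℕ
    ℓ = length L

    inU outU : Fin n → ℕ
    inU v  = 𝟙 (v ∈ₛ? U)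
    outU w = 𝟙 (w ∈ₛ? ∁ U)

    new : Fin n → Fin n → ℕ
    new v w = 𝟙 (¬? (c v w ∈? L))

    out : Fin n → ℕ
    out v = ∑[ w < n ] (outU w * new v w)

    -- An edge at v ∈ U either has its colour in L or leaves U with a new
    -- colour, since edges inside U have their colours in L.
    edge-split : ∀ {v} → v ∈ₛ U → ∀ w → 𝟙 (¬? (w ≟ v)) ≤ outU w * new v w + 𝟙 (InL? v L w)
    edge-split {v} v∈U w with w ≟ v | c v w ∈? L
    ... | yes _   | _         = z≤n
    ... | no  _   | yes _     = m≤n+m 1 _
    ... | no  w≢v | no cvw∉L with w ∈ₛ? ∁ U
    ...   | yes _    = s≤s z≤n
    ...   | no  w∉∁U = contradiction (closed v∈U (x∉∁p⇒x∈p w∉∁U) (≢-sym w≢v)) cvw∉L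

    coloured-in-L : ∀ v → incidentIn v L + 𝟙 (v ≟ a) ≤ ℓ
    coloured-in-L v with v ≟ a
    ... | yes refl = subst (_≤ ℓ) (+-comm 1 _) (incidentIn-< v y∈L y-absent)
    ... | no  _    = subst (_≤ ℓ) (sym (+-identityʳ _)) (incidentIn-≤ v)

    vertex-bound : ∀ v → v ∈ₛ U → n + 𝟙 (v ≟ a) ≤ out v + suc ℓ
    vertex-bound v v∈U = begin
      n + 𝟙 (v ≟ a)                                     ≡⟨ cong (_+ 𝟙 (v ≟ a)) (∑-others v) ⟨
      ∑[ w < n ] 𝟙 (¬? (w ≟ v)) + 1 + 𝟙 (v ≟ a)         ≤⟨ +-monoˡ-≤ (𝟙 (v ≟ a)) (+-monoˡ-≤ 1 (∑-mono-≤ (edge-split v∈U))) ⟩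
      ∑[ w < n ] (outU w * new v w + 𝟙 (InL? v L w)) + 1 + 𝟙 (v ≟ a)
                                                        ≡⟨ cong (λ s → s + 1 + 𝟙 (v ≟ a)) (∑-distrib-+ (λ w → outU w * new v w) (λ w → 𝟙 (InL? v L w))) ⟩
      out v + incidentIn v L + 1 + 𝟙 (v ≟ a)            ≡⟨ rearrange (out v) (incidentIn v L) (𝟙 (v ≟ a)) ⟩
      out v + suc (incidentIn v L + 𝟙 (v ≟ a))          ≤⟨ +-monoʳ-≤ (out v) (s≤s (coloured-in-L v)) ⟩
      out v + suc ℓ                                     ∎
      where
      open ≤-Reasoning
      rearrange : ∀ x y z → x + y + 1 + z ≡ x + suc (y + z)
      rearrange = solve-∀

    double-counting : ∑[ w < n ] (outU w * gain U L w) ≡ ∑[ v < n ] (inU v * out v)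
    double-counting = begin
      ∑[ w < n ] (outU w * gain U L w)                    ≡⟨ sum-cong-≗ (λ w → *-distribˡ-sum (outU w) (λ v → 𝟙 (fresh? U L w v))) ⟩
      ∑[ w < n ] ∑[ v < n ] (outU w * 𝟙 (fresh? U L w v))  ≡⟨ sum-cong-≗ (λ w → sum-cong-≗ (λ v → cong (outU w *_) (𝟙-× (v ∈ₛ? U) _))) ⟩
      ∑[ w < n ] ∑[ v < n ] (outU w * (inU v * new v w))   ≡⟨ ∑-comm (λ w v → outU w * (inU v * new v w)) ⟩
      ∑[ v < n ] ∑[ w < n ] (outU w * (inU v * new v w))   ≡⟨ sum-cong-≗ (λ v → sum-cong-≗ (λ w → x∙yz≈y∙xz (outU w) (inU v) (new v w))) ⟩
      ∑[ v < n ] ∑[ w < n ] (inU v * (outU w * new v w))   ≡⟨ sum-cong-≗ (λ v → *-distribˡ-sum (inU v) (λ w → outU w * new v w)) ⟨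
      ∑[ v < n ] (inU v * out v)                           ∎
      where open ≡-Reasoning

    weighted-vertex-bound : ∀ v → n * inU v + 𝟙 (v ≟ a) ≤ inU v * out v + suc ℓ * inU v
    weighted-vertex-bound v with v ∈ₛ? U
    ... | yes v∈U = begin
      n * 1 + 𝟙 (v ≟ a)       ≡⟨ cong (_+ 𝟙 (v ≟ a)) (*-identityʳ n) ⟩
      n + 𝟙 (v ≟ a)           ≤⟨ vertex-bound v v∈U ⟩
      out v + suc ℓ           ≡⟨ cong₂ _+_ (*-identityˡ (out v)) (*-identityʳ (suc ℓ)) ⟨
      1 * out v + suc ℓ * 1   ∎
      where open ≤-Reasoning
    ... | no v∉U = subst (_≤ 0 * out v + suc ℓ * 0) (sym (cong₂ _+_ (*-zeroʳ n) (not-a v∉U))) z≤n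
      where not-a : v ∉ₛ U → 𝟙 (v ≟ a) ≡ 0
            not-a v∉U with v ≟ a
            ... | yes refl = contradiction a∈U v∉U
            ... | no _     = refl

    total-gain : n * u + 1 ≤ ∑[ w < n ] (outU w * gain U L w) + suc ℓ * u
    total-gain = begin
      n * u + 1                                               ≡⟨ cong₂ _+_ (cong (n *_) ∣U∣≡∑) (sym (∑-δ a)) ⟩
      n * ∑[ v < n ] inU v + ∑[ v < n ] 𝟙 (v ≟ a)              ≡⟨ cong (_+ ∑[ v < n ] 𝟙 (v ≟ a)) (*-distribˡ-sum n inU) ⟩
      ∑[ v < n ] (n * inU v) + ∑[ v < n ] 𝟙 (v ≟ a)             ≡⟨ ∑-distrib-+ (λ v → n * inU v) (λ v → 𝟙 (v ≟ a)) ⟨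
      ∑[ v < n ] (n * inU v + 𝟙 (v ≟ a))                       ≤⟨ ∑-mono-≤ weighted-vertex-bound ⟩
      ∑[ v < n ] (inU v * out v + suc ℓ * inU v)                ≡⟨ ∑-distrib-+ (λ v → inU v * out v) (λ v → suc ℓ * inU v) ⟩
      ∑[ v < n ] (inU v * out v) + ∑[ v < n ] (suc ℓ * inU v)   ≡⟨ cong₂ _+_ double-counting (*-distribˡ-sum (suc ℓ) inU) ⟨
      ∑[ w < n ] (outU w * gain U L w) + suc ℓ * ∑[ v < n ] inU v ≡⟨ cong (λ s → ∑[ w < n ] (outU w * gain U L w) + suc ℓ * s) ∣U∣≡∑ ⟨
      ∑[ w < n ] (outU w * gain U L w) + suc ℓ * u              ∎
      where
      open ≤-Reasoning
      ∣U∣≡∑ : u ≡ ∑[ v < n ] inU v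
      ∣U∣≡∑ = trans (sym size) (∣p∣≡∑ U)

    good-vertex : ∀ j → j * (n ∸ u) + suc ℓ * u ≤ n * u → ∃ λ w → w ∉ₛ U × j < gain U L w
    good-vertex j enough with averaging (_∈ₛ? ∁ U) (gain U L) j average>j
      where
      open ≤-Reasoning
      average>j : j * ∑[ w < n ] outU w < ∑[ w < n ] (outU w * gain U L w)
      average>j = +-cancelʳ-< (suc ℓ * u) _ _ (begin-strict
        j * ∑[ w < n ] outU w + suc ℓ * u    ≡⟨ cong (λ k → j * k + suc ℓ * u) (trans (∑-∁ U) (cong (n ∸_) size)) ⟩
        j * (n ∸ u) + suc ℓ * u             ≤⟨ enough ⟩
        n * u                               <⟨ m<m+n (n * u) (s≤s z≤n) ⟩
        n * u + 1                           ≤⟨ total-gain ⟩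
        ∑[ w < n ] (outU w * gain U L w) + suc ℓ * u ∎)
    ... | w , w∈∁U , j<gain = w , x∈∁p⇒x∉p w∈∁U , j<gain

  Goal : ℕ → Set
  Goal m = ∃ λ U → ∣ U ∣ ≡ m × UsesAtLeast c U n

  finish : ∀ {m} (S : Stage m) → n ≤ length (Stage.L S) → Goal m
  finish S n≤ℓ = U , size , colour , colour-injective , λ t → used (∈-lookup (inject≤ t n≤ℓ))
    where
    open Stage S
    colour : Fin n → ℕ
    colour t = lookup L (inject≤ t n≤ℓ)
    colour-injective : Injective _≡_ _≡_ colour
    colour-injective {t} {t'} eq = inject≤-injective n≤ℓ n≤ℓ t t' (lookup-injective unique _ _ eq)

  -- With t
  -- steps left we keep n ≤ ℓ + 2t; a step then never needs more than two new
  -- colours, and averaging supplies as many as are needed.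
  module Greedy (m : ℕ) (m≤n : m ≤ n) (n+2≤2m : n + 2 ≤ 2 * m) where

    module _ {u t} (T : Seeded u) (u+t+1≡m : u + suc t ≡ m) where
      open Seeded T
      open Counting T

      private
        u<n : u < n
        u<n = ≤-trans (≤-trans (m<m+n u (s≤s z≤n)) (≤-reflexive u+t+1≡m)) m≤n

        n≡ : n ≤ ℓ + 2 * suc t → ¬ n ≤ suc (ℓ + 2 * t) → n ≡ ℓ + 2 * t + 2
        n≡ invariant two-more = ≤-antisym (≤-trans invariant (≤-reflexive (two-steps ℓ t)))
                                          (≤-trans (≤-reflexive (+-comm _ 2)) (≰⇒> two-more))
          where two-steps : ∀ ℓ t → ℓ + 2 * suc t ≡ ℓ + 2 * t + 2
                two-steps = solve-∀

        ℓ+2≤2u : n ≤ ℓ + 2 * suc t → ¬ n ≤ suc (ℓ + 2 * t) → ℓ + 2 ≤ 2 * u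
        ℓ+2≤2u invariant two-more = +-cancelʳ-≤ (2 * suc t) _ _ (begin
          ℓ + 2 + 2 * suc t     ≡⟨ regroup ℓ t ⟩
          ℓ + 2 * t + 2 + 2     ≡⟨ cong (_+ 2) (n≡ invariant two-more) ⟨
          n + 2                 ≤⟨ n+2≤2m ⟩
          2 * m                 ≡⟨ cong (2 *_) u+t+1≡m ⟨
          2 * (u + suc t)       ≡⟨ *-distribˡ-+ 2 u (suc t) ⟩
          2 * u + 2 * suc t     ∎)
          where open ≤-Reasoning
                regroup : ∀ ℓ t → ℓ + 2 + 2 * suc t ≡ ℓ + 2 * t + 2 + 2
                regroup = solve-∀

      -- Depending on how far ℓ + 2t falls short of n, any vertex, a vertex of
      -- positive gain, or a vertex of gain at least 2 is needed.
      step : n ≤ ℓ + 2 * suc t → ∃ λ w → w ∉ₛ U × n ≤ ℓ + 2 * t + gain U L w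
      step invariant with n ≤? ℓ + 2 * t | n ≤? suc (ℓ + 2 * t)
      ... | yes enough | _ with ∃-∉ U (subst (_< n) (sym size) u<n)
      ...   | w , w∉U = w , w∉U , ≤-trans enough (m≤m+n _ _)
      step invariant | no short | yes one-more with good-vertex 0 (*-monoˡ-≤ u ℓ<n)
        where ℓ<n : suc ℓ ≤ n
              ℓ<n = ≤-trans (s≤s (m≤m+n ℓ (2 * t))) (≰⇒> short)
      ...   | w , w∉U , 0<gain = w , w∉U , ≤-trans one-more (≤-trans (≤-reflexive (+-comm 1 _)) (+-monoʳ-≤ _ 0<gain))
      step invariant | no short | no two-more with good-vertex 1 tight
        where
        tight : 1 * (n ∸ u) + suc ℓ * u ≤ n * u
        tight = subst (λ N → 1 * (N ∸ u) + suc ℓ * u ≤ N * u) (sym (n≡ invariant two-more))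
                      (tight-step-arith ℓ t u (subst (u ≤_) (n≡ invariant two-more) (<⇒≤ u<n)) (ℓ+2≤2u invariant two-more))
      ...   | w , w∉U , 1<gain = w , w∉U , ≤-trans (≤-reflexive (n≡ invariant two-more)) (+-monoʳ-≤ _ 1<gain)

    grow : ∀ t {u} → u + t ≡ m → (T : Seeded u) → n ≤ Counting.ℓ T + 2 * t → Goal m
    grow zero    {u} u+0≡m T invariant =
      subst Goal (trans (sym (+-identityʳ u)) u+0≡m) (finish (Seeded.stage T) (subst (n ≤_) (+-identityʳ _) invariant))
    grow (suc t) {u} u+t+1≡m T invariant with step T u+t+1≡m invariant
    ... | w , w∉U , invariant′ =
      grow t (trans (sym (+-suc u t)) u+t+1≡m) (extendSeeded T w w∉U) (subst (n ≤_) ℓ′+2t invariant′)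
      where
      open Seeded T
      ℓ′+2t : length L + 2 * t + gain U L w ≡ length (Stage.L (extend stage w w∉U)) + 2 * t
      ℓ′+2t = trans (swap (length L) (2 * t) (gain U L w)) (cong (_+ 2 * t) (sym (length-extend stage w w∉U)))
        where swap : ∀ x y z → x + y + z ≡ x + z + y
              swap = solve-∀

  triangle : ∀ {a b d} → AbsentAt a (c b d) → b ≢ d → Seeded 3
  triangle {a} {b} {d} absent b≢d = record
    { stage = record { U = U₀ ; size = size₀ ; L = L₀ ; unique = unique₀ ; used = used₀ ; closed = closed₀ }
    ; a = a ; a∈U = a∈U₀ ; y = c b d ; y∈L = here refl ; y-absent = absent }
    where
    b≢a : b ≢ a
    b≢a refl = absent d (≢-sym b≢d) refl
    d≢a : d ≢ a
    d≢a refl = absent b b≢d (c-sym d b (≢-sym b≢d))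
    U₀ : Subset n
    U₀ = (⁅ a ⁆ ∪ ⁅ b ⁆) ∪ ⁅ d ⁆
    L₀ : List ℕ
    L₀ = c b d ∷ c a b ∷ c a d ∷ []
    a∈U₀ : a ∈ₛ U₀
    a∈U₀ = p⊆p∪q ⁅ d ⁆ (p⊆p∪q ⁅ b ⁆ (x∈⁅x⁆ a))
    b∈U₀ : b ∈ₛ U₀
    b∈U₀ = p⊆p∪q ⁅ d ⁆ (q⊆p∪q ⁅ a ⁆ ⁅ b ⁆ (x∈⁅x⁆ b))
    d∈U₀ : d ∈ₛ U₀
    d∈U₀ = q⊆p∪q (⁅ a ⁆ ∪ ⁅ b ⁆) ⁅ d ⁆ (x∈⁅x⁆ d)
    size₀ : ∣ U₀ ∣ ≡ 3
    size₀ = begin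
      ∣ (⁅ a ⁆ ∪ ⁅ b ⁆) ∪ ⁅ d ⁆ ∣   ≡⟨ ∣p∪⁅w⁆∣ (⁅ a ⁆ ∪ ⁅ b ⁆) d d∉ ⟩
      suc ∣ ⁅ a ⁆ ∪ ⁅ b ⁆ ∣         ≡⟨ cong suc (∣p∪⁅w⁆∣ ⁅ a ⁆ b (λ b∈ → b≢a (x∈⁅y⁆⇒x≡y a b∈))) ⟩
      suc (suc ∣ ⁅ a ⁆ ∣)           ≡⟨ cong (λ k → suc (suc k)) (∣⁅x⁆∣≡1 a) ⟩
      3                             ∎
      where
      open ≡-Reasoning
      d∉ : d ∉ₛ ⁅ a ⁆ ∪ ⁅ b ⁆
      d∉ d∈ with x∈p∪q⁻ ⁅ a ⁆ ⁅ b ⁆ d∈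
      ... | inj₁ d∈a = d≢a (x∈⁅y⁆⇒x≡y a d∈a)
      ... | inj₂ d∈b = b≢d (sym (x∈⁅y⁆⇒x≡y b d∈b))
    unique₀ : Unique L₀
    unique₀ = ((λ eq → absent b b≢a (sym eq)) ∷ (λ eq → absent d d≢a (sym eq)) ∷ [])
            ∷ (proper a b d (≢-sym b≢a) (≢-sym d≢a) b≢d ∷ []) ∷ [] ∷ []
    used₀ : ∀ {z} → z ∈ L₀ → UsedOn c U₀ z
    used₀ (here refl)                 = b , d , b∈U₀ , d∈U₀ , b≢d , refl
    used₀ (there (here refl))         = a , b , a∈U₀ , b∈U₀ , ≢-sym b≢a , refl
    used₀ (there (there (here refl))) = a , d , a∈U₀ , d∈U₀ , ≢-sym d≢a , refl
    corners : ∀ {x} → x ∈ₛ U₀ → x ≡ a ⊎ x ≡ b ⊎ x ≡ d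
    corners x∈ with x∈p∪q⁻ (⁅ a ⁆ ∪ ⁅ b ⁆) ⁅ d ⁆ x∈
    ... | inj₂ x∈d = inj₂ (inj₂ (x∈⁅y⁆⇒x≡y d x∈d))
    ... | inj₁ x∈ab with x∈p∪q⁻ ⁅ a ⁆ ⁅ b ⁆ x∈ab
    ...   | inj₁ x∈a = inj₁ (x∈⁅y⁆⇒x≡y a x∈a)
    ...   | inj₂ x∈b = inj₂ (inj₁ (x∈⁅y⁆⇒x≡y b x∈b))
    closed₀ : ∀ {i j} → i ∈ₛ U₀ → j ∈ₛ U₀ → i ≢ j → c i j ∈ L₀
    closed₀ i∈ j∈ i≢j with corners i∈ | corners j∈
    ... | inj₁ refl        | inj₁ refl        = contradiction refl i≢j
    ... | inj₁ refl        | inj₂ (inj₁ refl) = there (here refl)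
    ... | inj₁ refl        | inj₂ (inj₂ refl) = there (there (here refl))
    ... | inj₂ (inj₁ refl) | inj₁ refl        = there (here (c-sym b a b≢a))
    ... | inj₂ (inj₁ refl) | inj₂ (inj₁ refl) = contradiction refl i≢j
    ... | inj₂ (inj₁ refl) | inj₂ (inj₂ refl) = here refl
    ... | inj₂ (inj₂ refl) | inj₁ refl        = there (there (here (c-sym d a d≢a)))
    ... | inj₂ (inj₂ refl) | inj₂ (inj₁ refl) = here (c-sym d b (≢-sym b≢d))
    ... | inj₂ (inj₂ refl) | inj₂ (inj₂ refl) = contradiction refl i≢j

  -- Given n distinct colours, a colour absent at any vertex a is used on
  -- some edge bd, which yields a seed with 3 vertices and 3 colours.
  seed : Fin n → UsesAtLeast c ⊤ n → Σ (Seeded 3) λ T → length (Seeded.L T) ≡ 3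
  seed a (f , f-inj , f-used) with absent-colour a f f-inj
  ... | t , absent with f-used t
  ...   | b , d , _ , _ , b≢d , cbd≡ft = triangle (subst (AbsentAt a) (sym cbd≡ft) absent) b≢d , refl

  -- For n = 5 one
  -- greedy step reaches 4 = ⌊(n+3)/2⌋ vertices.  For n ≥ 6 a first step
  -- gaining three colours reaches 4 vertices and 6 colours, from which the
  -- invariant n ≤ ℓ + 2t of the greedy phase holds.
  grow-seed : 5 ≤ n → (T₀ : Seeded 3) → length (Seeded.L T₀) ≡ 3 → Goal ((n + 3) / 2)
  grow-seed 5≤n T₀ ℓ₀≡3 with n ≤? 5
  ... | yes n≤5 = subst Goal (cong (λ k → (k + 3) / 2) (sym n≡5))
                    (Greedy.grow 4 (≤-trans (s≤s (s≤s (s≤s (s≤s z≤n)))) 5≤n) (≤-trans (≤-reflexive (cong (_+ 2) n≡5)) (n≤1+n 7))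
                                 1 refl T₀ (≤-reflexive (trans n≡5 (cong (_+ 2) (sym ℓ₀≡3)))))
    where n≡5 = ≤-antisym n≤5 5≤n
  ... | no  n≰5 with Counting.good-vertex T₀ 2 (subst (λ ℓ → 2 * (n ∸ 3) + suc ℓ * 3 ≤ n * 3) (sym ℓ₀≡3) (first-step-arith (≰⇒> n≰5)))
  ...   | w , w∉U , 2<gain =
    Greedy.grow q (target-≤ (≤-trans (s≤s (s≤s (s≤s z≤n))) 5≤n)) (target-large n)
                (q ∸ 4) (m+[n∸m]≡n 4≤q) (extendSeeded T₀ w w∉U) invariant
    where
    open Seeded T₀
    q = (n + 3) / 2
    4≤q : 4 ≤ q
    4≤q = *-cancelˡ-≤ 2 (≤-trans (+-monoˡ-≤ 2 (≰⇒> n≰5)) (target-large n))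
    invariant : n ≤ length (Stage.L (extend stage w w∉U)) + 2 * (q ∸ 4)
    invariant = +-cancelʳ-≤ 2 _ _ (begin
      n + 2                                            ≤⟨ target-large n ⟩
      2 * q                                            ≡⟨ cong (2 *_) (m+[n∸m]≡n 4≤q) ⟨
      2 * (4 + (q ∸ 4))                                ≡⟨ regroup (q ∸ 4) ⟩
      3 + 3 + 2 * (q ∸ 4) + 2                          ≤⟨ +-monoˡ-≤ 2 (+-monoˡ-≤ (2 * (q ∸ 4)) (+-monoʳ-≤ 3 2<gain)) ⟩
      3 + gain U L w + 2 * (q ∸ 4) + 2                 ≡⟨ cong (λ ℓ → ℓ + gain U L w + 2 * (q ∸ 4) + 2) ℓ₀≡3 ⟨
      length L + gain U L w + 2 * (q ∸ 4) + 2          ≡⟨ cong (λ ℓ → ℓ + 2 * (q ∸ 4) + 2) (length-extend stage w w∉U) ⟨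
      length (Stage.L (extend stage w w∉U)) + 2 * (q ∸ 4) + 2 ∎)
      where
      open ≤-Reasoning
      regroup : ∀ r → 2 * (4 + r) ≡ 3 + 3 + 2 * r + 2
      regroup = solve-∀

  part-i : 5 ≤ n → UsesAtLeast c ⊤ n → Goal ((n + 3) / 2)
  part-i 5≤n colours = grow-seed 5≤n (proj₁ seeded) (proj₂ seeded)
    where seeded = seed (fromℕ< (≤-trans (s≤s z≤n) 5≤n)) colours

  -- If all colours lie in a duplicate-free list of n - 1 colours, then each
  -- of them occurs at every vertex, as the n - 1 edges at v use distinct ones.
  present-colour : ∀ (Cs : List ℕ) → Unique Cs → length Cs + 1 ≡ n →
    (∀ v w → w ≢ v → c v w ∈ Cs) → ∀ {z} → z ∈ Cs → ∀ v → ∃ λ w → w ≢ v × c v w ≡ z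
  present-colour Cs Cs-unique ∣Cs∣ all-in {z} z∈Cs v with z ∈? incidentColours v
  ... | yes z∈ = ∈-incidentColours⁻ z∈
  ... | no  z∉ = contradiction too-many (<⇒≱ (begin-strict
      length Cs                        <⟨ m<m+n _ (s≤s z≤n) ⟩
      length Cs + 1                    ≡⟨ trans ∣Cs∣ (sym (length-incidentColours v)) ⟩
      length (incidentColours v) + 1   ≡⟨ +-comm _ 1 ⟩
      suc (length (incidentColours v)) ∎))
    where
    open ≤-Reasoning
    too-many : suc (length (incidentColours v)) ≤ length Cs
    too-many = Unique-⊆⇒length≤ (All.tabulate (λ z'∈ z≡z' → z∉ (subst (_∈ _) (sym z≡z') z'∈)) ∷ incidentColours-unique v) ⊆Cs
      where ⊆Cs : ∀ {x} → x ∈ _ ∷ incidentColours v → x ∈ Cs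
            ⊆Cs (here refl) = z∈Cs
            ⊆Cs (there x∈) with ∈-incidentColours⁻ x∈
            ... | w , w≢v , refl = all-in v w w≢v

  -- A colour present at every vertex forms a perfect matching; a vertex set
  -- containing more than half of the vertices must then contain one of its edges.
  module ColourClass {z : ℕ} (present : ∀ v → ∃ λ w → w ≢ v × c v w ≡ z) where

    partner : Fin n → Fin n
    partner v = proj₁ (present v)

    partner≢ : ∀ v → partner v ≢ v
    partner≢ v = proj₁ (proj₂ (present v))

    partner-colour : ∀ v → c v (partner v) ≡ z
    partner-colour v = proj₂ (proj₂ (present v))

    -- Two vertices with the same partner w see the colour z at w twice.
    partner-injective : ∀ {v v'} → partner v ≡ partner v' → v ≡ v'
    partner-injective {v} {v'} eq = colour-injective-at w (≢-sym (partner≢ v)) v'≢w (begin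
      c w v              ≡⟨ c-sym w v (partner≢ v) ⟩
      c v w              ≡⟨ partner-colour v ⟩
      z                  ≡⟨ partner-colour v' ⟨
      c v' (partner v')  ≡⟨ cong (c v') eq ⟨
      c v' w             ≡⟨ c-sym v' w v'≢w ⟩
      c w v'             ∎)
      where
      open ≡-Reasoning
      w = partner v
      v'≢w : v' ≢ w
      v'≢w v'≡w = partner≢ v' (trans (sym eq) (sym v'≡w))

    -- If no edge of U had colour z, partner would map U injectively into
    -- its complement, forcing |U| ≤ n - |U|.
    used-on-large : ∀ U → n < ∣ U ∣ + ∣ U ∣ → UsedOn c U z
    used-on-large U n<2∣U∣ with any? (λ v → (v ∈ₛ? U) ×-dec (partner v ∈ₛ? U))
    ... | yes (v , v∈U , pv∈U) = v , partner v , v∈U , pv∈U , ≢-sym (partner≢ v) , partner-colour v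
    ... | no  closed-edge-free = contradiction (begin
        ∣ U ∣ + ∣ U ∣            ≤⟨ +-monoʳ-≤ ∣ U ∣ ∣U∣≤∣∁U∣ ⟩
        ∣ U ∣ + (n ∸ ∣ U ∣)      ≡⟨ m+[n∸m]≡n (∣p∣≤n U) ⟩
        n                       ∎) (<⇒≱ n<2∣U∣)
      where
      open ≤-Reasoning
      members nonMembers : List (Fin n)
      members    = filter (_∈ₛ? U) (allFin n)
      nonMembers = filter (_∈ₛ? ∁ U) (allFin n)
      maps-out : ∀ {x} → x ∈ map partner members → x ∈ nonMembers
      maps-out x∈ with ∈-map⁻ partner x∈
      ... | v , v∈ , refl = ∈-filter⁺ (_∈ₛ? ∁ U) (∈-allFin (partner v))
              (x∉p⇒x∈∁p (λ pv∈U → closed-edge-free (v , proj₂ (∈-filter⁻ (_∈ₛ? U) {xs = allFin n} v∈) , pv∈U)))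
      ∣U∣≤∣∁U∣ : ∣ U ∣ ≤ n ∸ ∣ U ∣
      ∣U∣≤∣∁U∣ = begin
        ∣ U ∣                         ≡⟨ ∣p∣≡∑ U ⟩
        ∑[ x < n ] 𝟙 (x ∈ₛ? U)        ≡⟨ ∑-𝟙≡length-filter (_∈ₛ? U) (λ x → x) ⟩
        length members                ≡⟨ length-map partner members ⟨
        length (map partner members)  ≤⟨ Unique-⊆⇒length≤ (Unique.map⁺ partner-injective (Unique.filter⁺ (_∈ₛ? U) (Unique.allFin⁺ n))) maps-out ⟩
        length nonMembers             ≡⟨ ∑-𝟙≡length-filter (_∈ₛ? ∁ U) (λ x → x) ⟨
        ∑[ x < n ] 𝟙 (x ∈ₛ? ∁ U)      ≡⟨ ∑-∁ U ⟩
        n ∸ ∣ U ∣                     ∎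

  all-colours-on-large : 1 ≤ n → UsesExactly c ⊤ (n ∸ 1) →
    ∀ U → n < ∣ U ∣ + ∣ U ∣ → UsesExactly c U (n ∸ 1)
  all-colours-on-large 1≤n (f , f-inj , _ , f-onto) U n<2∣U∣ =
    f , f-inj , (λ t → ColourClass.used-on-large (present (f∈Cs t)) U n<2∣U∣) , λ x x-used → f-onto x (widen x-used)
    where
    Cs = map f (allFin (n ∸ 1))
    f∈Cs : ∀ t → f t ∈ Cs
    f∈Cs t = ∈-map⁺ f (∈-allFin t)
    ∣Cs∣ : length Cs + 1 ≡ n
    ∣Cs∣ = trans (cong (_+ 1) (trans (length-map f (allFin (n ∸ 1))) (length-tabulate (λ t → t)))) (m∸n+n≡m 1≤n)
    every-edge-in-Cs : ∀ v w → w ≢ v → c v w ∈ Cs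
    every-edge-in-Cs v w w≢v with f-onto (c v w) (v , w , ∈⊤ , ∈⊤ , ≢-sym w≢v , refl)
    ... | t , ft≡cvw = subst (_∈ Cs) ft≡cvw (f∈Cs t)
    present = present-colour Cs (Unique.map⁺ f-inj (Unique.allFin⁺ (n ∸ 1))) ∣Cs∣ every-edge-in-Cs
    widen : ∀ {x} → UsedOn c U x → UsedOn c ⊤ x
    widen (i , j , _ , _ , i≢j , cij≡x) = i , j , ∈⊤ , ∈⊤ , i≢j , cij≡x

proposition3 : (n : ℕ) → 5 ≤ n → (c : Colouring n) → IsEdgeColouring c → Proper c →
    ((UsesAtLeast c ⊤ n → ∃[ U ] (∣ U ∣ ≡ ((n + 3) / 2) × UsesAtLeast c U n))
    × (UsesExactly c ⊤ (n ∸ 1) → ∃[ U ] (∣ U ∣ ≡ (n / 2 + 1) × UsesExactly c U (n ∸ 1))))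
proposition3 n 5≤n c c-sym proper = part-i 5≤n , part-ii
  where
  open ProperColouring c c-sym proper
  part-ii : UsesExactly c ⊤ (n ∸ 1) → ∃[ U ] (∣ U ∣ ≡ (n / 2 + 1) × UsesExactly c U (n ∸ 1))
  part-ii colours with subset-of-size (n / 2 + 1) (half-plus-one-≤ (≤-trans (s≤s (s≤s z≤n)) 5≤n))
  ... | U , ∣U∣≡k = U , ∣U∣≡k , all-colours-on-large (≤-trans (s≤s z≤n) 5≤n) colours U
                                   (subst (λ k → n < k + k) (sym ∣U∣≡k) (half-plus-one-> n))
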